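{- Let $\Gamma$ be a tetravalent graph of girth $5$ and let $G\le\mathrm{Aut}(\Gamma)$ be half-arc-transitive on $\Gamma$. Then, with respect to a $G$-induced orientation, $\Gamma$ has no $5$-cycles of type $2$.
   Context: Graphs are finite, simple, connected. $G\le\mathrm{Aut}(\Gamma)$ is half-arc-transitive if transitive on vertices and edges but not on arcs (ordered pairs of adjacent vertices). Then $G$ has two orbits on arcs, each containing exactly one of $(u,v),(v,u)$ per edge; each orbit is a $G$-induced orientation $\vec\Gamma$. Type of a $5$-cycle $C$ with respect to $\vec\Gamma$: if some vertex of $C$ is the head of both or the tail of both arcs of $\vec\Gamma$ on the two edges of $C$ at it, then the type of $C$ is the largest $s$ such that $C$ contains a directed path of length $s$ of $\vec\Gamma$ (so $2\le s\le4$); otherwise $C$ is of type $5$ (directed). Types do not depend on which of the two $G$-induced orientations is used. -}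

module Defs where

open import Data.Bool using (Bool; true; false; T)
open import Data.Nat using (ℕ; zero; suc; _≤_; _<_)
open import Data.Fin using (Fin; zero; suc)
open import Data.List using (length; filterᵇ; allFin)
open import Data.Product using (Σ; ∃; _×_; _,_)
open import Data.Sum using (_⊎_)
open import Relation.Nullary using (¬_)
open import Relation.Binary.PropositionalEquality using (_≡_)
open import Relation.Binary.Construct.Closure.ReflexiveTransitive using (Star)
open import Function.Definitions using (Injective; Surjective)

record Graph : Set where
  field
    n      : ℕ
    adj    : Fin n → Fin n → Bool
    sym    : ∀ u v → adj u v ≡ adj v u
    irrefl : ∀ u → adj u u ≡ false
    connected : ∀ u v → Star (λ x y → T (adj x y)) u v

module _ (Γ : Graph) where
  open Graph Γ

  V : Set
  V = Fin n

  E : V → V → Set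
  E u v = T (adj u v)

  degree : V → ℕ
  degree u = length (filterᵇ (adj u) (allFin n))

  Tetravalent : Set
  Tetravalent = ∀ u → degree u ≡ 4

-- cyclic successor on Fin (suc m):  i ↦ i + 1 mod (suc m)
next : ∀ {m} → Fin (suc m) → Fin (suc m)
next {zero} zero = zero
next {suc m} zero = suc zero
next {suc m} (suc i) with next {m} i
... | zero = zero
... | suc j = suc (suc j)

-- a cycle of length (suc m): injective cyclic sequence of adjacent vertices
record Cycle (Γ : Graph) (m : ℕ) : Set where
  field
    vtx : Fin (suc m) → V Γ
    inj : Injective _≡_ _≡_ vtx
    edges : ∀ i → E Γ (vtx i) (vtx (next i))

-- girth: length of a shortest cycle (cycles have length ≥ 3)
HasGirth : Graph → ℕ → Set
HasGirth Γ g =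
  (∃ λ m → (suc m ≡ g) × Cycle Γ m)
  × (∀ m → 2 ≤ m → Cycle Γ m → g ≤ suc m)

IsAutomorphism : (Γ : Graph) → (V Γ → V Γ) → Set
IsAutomorphism Γ g =
  Injective _≡_ _≡_ g × Surjective _≡_ _≡_ g
  × (∀ u v → (E Γ u v → E Γ (g u) (g v)) × (E Γ (g u) (g v) → E Γ u v))

record AutGroup (Γ : Graph) : Set₁ where
  field
    mem  : (V Γ → V Γ) → Set
    auto    : ∀ g → mem g → IsAutomorphism Γ g
    id∈     : mem (λ x → x)
    comp∈   : ∀ g h → mem g → mem h → mem (λ x → g (h x))
    inv∈    : ∀ g → mem g → ∃ λ h → mem h × (∀ x → h (g x) ≡ x) × (∀ x → g (h x) ≡ x)

module _ {Γ : Graph} (G : AutGroup Γ) where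
  open AutGroup G

  VertexTransitive : Set
  VertexTransitive = ∀ u v → ∃ λ g → mem g × g u ≡ v

  EdgeTransitive : Set
  EdgeTransitive = ∀ u v x y → E Γ u v → E Γ x y →
    ∃ λ g → mem g × ((g u ≡ x × g v ≡ y) ⊎ (g u ≡ y × g v ≡ x))

  ArcTransitive : Set
  ArcTransitive = ∀ u v x y → E Γ u v → E Γ x y →
    ∃ λ g → mem g × g u ≡ x × g v ≡ y

  HalfArcTransitive : Set
  HalfArcTransitive = VertexTransitive × EdgeTransitive × ¬ ArcTransitive

  -- the G-orbit of the arc (a , b): a G-induced orientation (when (a,b) is an arc)
  InducedOrientation : V Γ → V Γ → V Γ → V Γ → Set
  InducedOrientation a b u v = ∃ λ g → mem g × g a ≡ u × g b ≡ v

step : Fin 5 → ℕ → Fin 5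
step i zero = i
step i (suc k) = next (step i k)

prev : Fin 5 → Fin 5
prev i = step i 4

module _ {A : Set} (D : A → A → Set) (c : Fin 5 → A) where

  HasDirPath : ℕ → Set
  HasDirPath s = ∃ λ i →
      (∀ k → k < s → D (c (step i k)) (c (step i (suc k))))
    ⊎ (∀ k → k < s → D (c (step i (suc k))) (c (step i k)))

  NonDirected : Set
  NonDirected = ∃ λ i →
      (D (c (prev i)) (c i) × D (c (next i)) (c i))
    ⊎ (D (c i) (c (prev i)) × D (c i) (c (next i)))

  HasType : ℕ → Set
  HasType s =
      (s ≡ 5 × ¬ NonDirected)
    ⊎ (2 ≤ s × s ≤ 4 × NonDirected × HasDirPath s × ¬ HasDirPath (suc s))

-- Every vertex then has at most two out- and at most two in-neighbours, since by vertex
-- transitivity it also has the two in- (out-)neighbours of any other vertex.  Up to rotation,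
-- reflection and reversing R, a 5-cycle of type 2 is u₀→u₁→u₂←u₃→u₄←u₀.  The element g ∈ G
-- taking the arc u₃u₄ to u₀u₄ is pinned down on u₀, u₂, u₁ by the valency bounds and maps
-- u₁→u₂ to u₂→u₁, which is impossible in an orientation.
{-# OPTIONS --safe #-}
module Submission where

open import Defs
open import Data.Empty using (⊥; ⊥-elim)
open import Data.Bool using (T; T?)
open import Data.Nat as ℕ using (ℕ; _≤_; _<_; s≤s)
open import Data.Fin using (Fin; zero; suc; _≟_)
open import Data.Fin.Properties using (injective⇒≤)
open import Data.List using (filterᵇ; allFin)
open import Data.List.Membership.Propositional using (_∈_)
open import Data.List.Membership.Propositional.Properties using (∈-filter⁺; ∈-allFin)
open import Data.List.Relation.Unary.Any using (index)
open import Data.List.Relation.Unary.Any.Properties using (lookup-index)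
import Data.List as List
open import Data.Vec using (Vec; []; _∷_; lookup)
open import Data.Vec.Relation.Unary.All using (All; []; _∷_)
open import Data.Vec.Relation.Unary.All.Properties using (lookup⁺)
open import Data.Vec.Relation.Unary.Unique.Propositional using (Unique; []; _∷_)
open import Data.Vec.Relation.Unary.Unique.Propositional.Properties using (lookup-injective)
open import Data.Product using (∃; _×_; _,_)
open import Data.Sum using (_⊎_; inj₁; inj₂; swap)
open import Function using (_∘_; flip)
open import Function.Definitions using (Injective)
open import Relation.Nullary using (¬_)
open import Relation.Nullary.Decidable using (decidable-stable)
open import Relation.Binary.PropositionalEquality
  using (_≡_; _≢_; refl; sym; trans; cong; subst; subst₂)

step-5 : ∀ i → step i 5 ≡ i
step-5 zero = refl
step-5 (suc zero) = refl
step-5 (suc (suc zero)) = refl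
step-5 (suc (suc (suc zero))) = refl
step-5 (suc (suc (suc (suc zero)))) = refl

≢-step-2 : ∀ i → i ≢ step i 2
≢-step-2 zero ()
≢-step-2 (suc zero) ()
≢-step-2 (suc (suc zero)) ()
≢-step-2 (suc (suc (suc zero))) ()
≢-step-2 (suc (suc (suc (suc zero)))) ()

≢-step-3 : ∀ i → i ≢ step i 3
≢-step-3 zero ()
≢-step-3 (suc zero) ()
≢-step-3 (suc (suc zero)) ()
≢-step-3 (suc (suc (suc zero))) ()
≢-step-3 (suc (suc (suc (suc zero)))) ()

module _ {A : Set} (D : A → A → Set) (c : Fin 5 → A) where

  forward-path₃ : ∀ j → D (c j) (c (step j 1)) → D (c (step j 1)) (c (step j 2)) →
                  D (c (step j 2)) (c (step j 3)) → HasDirPath D c 3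
  forward-path₃ j d₀ d₁ d₂ =
    j , inj₁ λ { 0 _ → d₀ ; 1 _ → d₁ ; 2 _ → d₂ ; (ℕ.suc (ℕ.suc (ℕ.suc _))) (s≤s (s≤s (s≤s ()))) }

  backward-path₃ : ∀ j → D (c (step j 1)) (c j) → D (c (step j 2)) (c (step j 1)) →
                   D (c (step j 3)) (c (step j 2)) → HasDirPath D c 3
  backward-path₃ j d₀ d₁ d₂ =
    j , inj₂ λ { 0 _ → d₀ ; 1 _ → d₁ ; 2 _ → d₂ ; (ℕ.suc (ℕ.suc (ℕ.suc _))) (s≤s (s≤s (s≤s ()))) }

  HasDirPath-flip : ∀ {s} → HasDirPath (flip D) c s → HasDirPath D c s
  HasDirPath-flip (i , inj₁ p) = i , inj₂ p
  HasDirPath-flip (i , inj₂ p) = i , inj₁ p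

module _ (Γ : Graph) where

  E-sym : ∀ {u v} → E Γ u v → E Γ v u
  E-sym {u} {v} = subst T (Graph.sym Γ u v)

  unique-neighbours≤degree : ∀ {w m} {xs : Vec (V Γ) m} →
                             Unique xs → All (E Γ w) xs → m ≤ degree Γ w
  unique-neighbours≤degree {w} {xs = xs} xs! adjacent = injective⇒≤ index-injective
    where
    neighbours = filterᵇ (Graph.adj Γ w) (allFin (Graph.n Γ))

    member : ∀ i → lookup xs i ∈ neighbours
    member i = ∈-filter⁺ (T? ∘ Graph.adj Γ w) (∈-allFin (lookup xs i)) (lookup⁺ adjacent i)

    index-injective : Injective _≡_ _≡_ (index ∘ member)
    index-injective {i} {j} eq = lookup-injective xs! i j same-vertex
      where
      same-vertex : lookup xs i ≡ lookup xs j
      same-vertex = trans (lookup-index (member i))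
                     (trans (cong (List.lookup neighbours) eq) (sym (lookup-index (member j))))

  tetravalent-¬5-neighbours : Tetravalent Γ → ∀ {w} {xs : Vec (V Γ) 5} →
                              Unique xs → ¬ All (E Γ w) xs
  tetravalent-¬5-neighbours tet {w} xs! adjacent
    with s≤s (s≤s (s≤s (s≤s ()))) ← subst (5 ≤_) (tet w) (unique-neighbours≤degree xs! adjacent)

module _ {Γ : Graph} (G : AutGroup Γ) where
  open AutGroup G

  mem-injective : ∀ {g} → mem g → Injective _≡_ _≡_ g
  mem-injective {g} g∈ = let (inj , _) = auto g g∈ in inj

  mem-preserves-E : ∀ {g x y} → mem g → E Γ x y → E Γ (g x) (g y)
  mem-preserves-E {g} {x} {y} g∈ = let (_ , _ , hom) = auto g g∈ ; (pres , _) = hom x y in pres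

  record IsArcOrbitOrientation (R : V Γ → V Γ → Set) : Set where
    field
      invariant  : ∀ {g x y} → mem g → R x y → R (g x) (g y)
      transitive : ∀ {x y z w} → R x y → R z w → ∃ λ g → mem g × g x ≡ z × g y ≡ w
      ⊆E         : ∀ {x y} → R x y → E Γ x y
      total      : ∀ {x y} → E Γ x y → R x y ⊎ R y x
      asym       : ∀ {x y} → R x y → ¬ R y x

  flip-isArcOrbitOrientation : ∀ {R} → IsArcOrbitOrientation R → IsArcOrbitOrientation (flip R)
  flip-isArcOrbitOrientation O = record
    { invariant  = invariant
    ; transitive = λ r s → let (g , g∈ , gy , gx) = transitive r s in g , g∈ , gx , gy
    ; ⊆E         = E-sym Γ ∘ ⊆E
    ; total      = λ e → swap (total e)
    ; asym       = asym
    }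
    where open IsArcOrbitOrientation O

  ArcsFrom : V Γ → V Γ → Set
  ArcsFrom x y = ∀ {u v} → E Γ u v → ∃ λ g → mem g × g x ≡ u × g y ≡ v

  arcsFrom⇒arcTransitive : ∀ {x y} → ArcsFrom x y → ArcTransitive G
  arcsFrom⇒arcTransitive from-xy u v p q euv epq
    with g , g∈ , gx , gy ← from-xy euv | h , h∈ , hx , hy ← from-xy epq
    with g⁻¹ , g⁻¹∈ , g⁻¹g , _ ← inv∈ g g∈
    = h ∘ g⁻¹ , comp∈ h g⁻¹ h∈ g⁻¹∈ , moves gx hx , moves gy hy
    where
    moves : ∀ {t a b} → g t ≡ a → h t ≡ b → h (g⁻¹ a) ≡ b
    moves {t} refl ht = trans (cong h (g⁻¹g t)) ht

  reversed-edge⇒arcsFrom : EdgeTransitive G → ∀ {s x y} → mem s → s x ≡ y → s y ≡ x →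
                           E Γ x y → ArcsFrom x y
  reversed-edge⇒arcsFrom et {s} {x} {y} s∈ sx sy exy euv with et x y _ _ exy euv
  ... | g , g∈ , inj₁ (gx , gy) = g , g∈ , gx , gy
  ... | g , g∈ , inj₂ (gx , gy) = g ∘ s , comp∈ g s g∈ s∈ , trans (cong g sx) gy , trans (cong g sy) gx

  module _ (hat : HalfArcTransitive G) {a b} (eab : E Γ a b) where
    private
      D = InducedOrientation G a b
      et : EdgeTransitive G
      et = let (_ , et , _) = hat in et

    inducedOrientation-transitive : ∀ {x y z w} → D x y → D z w → ∃ λ g → mem g × g x ≡ z × g y ≡ w
    inducedOrientation-transitive (h , h∈ , refl , refl) (k , k∈ , refl , refl)
      with h⁻¹ , h⁻¹∈ , h⁻¹h , _ ← inv∈ h h∈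
      = k ∘ h⁻¹ , comp∈ k h⁻¹ k∈ h⁻¹∈ , cong k (h⁻¹h a) , cong k (h⁻¹h b)

    -- An arc in both orbits would be reversed by some element of G, making G arc-transitive.
    inducedOrientation-isArcOrbitOrientation : IsArcOrbitOrientation D
    inducedOrientation-isArcOrbitOrientation = record
      { invariant  = λ { g∈ (h , h∈ , hx , hy) → _ , comp∈ _ h g∈ h∈ , cong _ hx , cong _ hy }
      ; transitive = inducedOrientation-transitive
      ; ⊆E         = λ { (h , h∈ , refl , refl) → mem-preserves-E h∈ eab }
      ; total      = total
      ; asym       = asym
      }
      where
      total : ∀ {x y} → E Γ x y → D x y ⊎ D y x
      total e with et a b _ _ eab e
      ... | g , g∈ , inj₁ (ga , gb) = inj₁ (g , g∈ , ga , gb)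
      ... | g , g∈ , inj₂ (ga , gb) = inj₂ (g , g∈ , ga , gb)

      asym : ∀ {x y} → D x y → ¬ D y x
      asym dxy@(h , h∈ , refl , refl) dyx with s , s∈ , sx , sy ← inducedOrientation-transitive dxy dyx
        = let (_ , _ , ¬at) = hat in
          ¬at (arcsFrom⇒arcTransitive (reversed-edge⇒arcsFrom et s∈ sx sy (mem-preserves-E h∈ eab)))

module OutValency {Γ : Graph} (tet : Tetravalent Γ) {G : AutGroup Γ} (vt : VertexTransitive G)
                  {R : V Γ → V Γ → Set} (O : IsArcOrbitOrientation G R) where
  open IsArcOrbitOrientation O

  out≢in : ∀ {w x y} → R w x → R y w → x ≢ y
  out≢in rx ry refl = asym rx ry

  ¬3-out-neighbours : ∀ {v v₁ v₂ w x y z} → R v₁ v → R v₂ v → v₁ ≢ v₂ →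
                      R w x → R w y → R w z → x ≢ y → x ≢ z → y ≢ z → ⊥
  ¬3-out-neighbours {v} {v₁} {v₂} {w} r₁ r₂ v₁≢v₂ rx ry rz x≢y x≢z y≢z
    with g , g∈ , refl ← vt v w
    = tetravalent-¬5-neighbours Γ tet distinct
        (⊆E rx ∷ ⊆E ry ∷ ⊆E rz ∷ E-sym Γ (⊆E r₁′) ∷ E-sym Γ (⊆E r₂′) ∷ [])
    where
    r₁′ = invariant g∈ r₁
    r₂′ = invariant g∈ r₂
    distinct : Unique (_ ∷ _ ∷ _ ∷ g v₁ ∷ g v₂ ∷ [])
    distinct = (x≢y ∷ x≢z ∷ out≢in rx r₁′ ∷ out≢in rx r₂′ ∷ [])
             ∷ (y≢z ∷ out≢in ry r₁′ ∷ out≢in ry r₂′ ∷ [])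
             ∷ (out≢in rz r₁′ ∷ out≢in rz r₂′ ∷ [])
             ∷ ((v₁≢v₂ ∘ mem-injective G g∈) ∷ [])
             ∷ [] ∷ []

  at-most-2-out-neighbours : ∀ {v v₁ v₂ w x y z} → R v₁ v → R v₂ v → v₁ ≢ v₂ →
                             R w x → R w y → x ≢ y → R w z → z ≢ x → z ≡ y
  at-most-2-out-neighbours r₁ r₂ v₁≢v₂ rx ry x≢y rz z≢x =
    decidable-stable (_ ≟ _) λ z≢y →
      ¬3-out-neighbours r₁ r₂ v₁≢v₂ rx ry rz x≢y (z≢x ∘ sym) (z≢y ∘ sym)

module Type2 {Γ : Graph} (tet : Tetravalent Γ) {G : AutGroup Γ} (vt : VertexTransitive G)
             {R : V Γ → V Γ → Set} (O : IsArcOrbitOrientation G R) where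
  open IsArcOrbitOrientation O
  open OutValency tet vt O using (at-most-2-out-neighbours)
  open OutValency tet vt (flip-isArcOrbitOrientation G O)
    renaming (at-most-2-out-neighbours to at-most-2-in-neighbours) using ()

  ¬type2-pentagon : ∀ {u₀ u₁ u₂ u₃ u₄} → R u₀ u₁ → R u₁ u₂ → R u₃ u₂ → R u₃ u₄ → R u₀ u₄ →
                    u₁ ≢ u₄ → u₂ ≢ u₄ → u₁ ≢ u₃ → u₀ ≢ u₃ → ⊥
  ¬type2-pentagon {u₀} {u₁} {u₂} {u₃} {u₄} r₀₁ r₁₂ r₃₂ r₃₄ r₀₄ u₁≢u₄ u₂≢u₄ u₁≢u₃ u₀≢u₃
    with g , g∈ , gu₃ , gu₄ ← transitive r₃₄ r₀₄
    = asym (subst₂ R gu₁ gu₂ (invariant g∈ r₁₂)) r₁₂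
    where
    injective = mem-injective G g∈

    out-of-u₀ : ∀ {z} → R u₀ z → z ≢ u₄ → z ≡ u₁
    out-of-u₀ = at-most-2-out-neighbours r₁₂ r₃₂ u₁≢u₃ r₀₄ r₀₁ (u₁≢u₄ ∘ sym)

    into-u₄ : ∀ {z} → R z u₄ → z ≢ u₀ → z ≡ u₃
    into-u₄ = at-most-2-in-neighbours r₀₁ r₀₄ u₁≢u₄ r₀₄ r₃₄ u₀≢u₃

    out-of-u₃ : ∀ {z} → R u₃ z → z ≢ u₄ → z ≡ u₂
    out-of-u₃ = at-most-2-out-neighbours r₁₂ r₃₂ u₁≢u₃ r₃₄ r₃₂ (u₂≢u₄ ∘ sym)

    gu₀ : g u₀ ≡ u₃
    gu₀ = into-u₄ (subst (R (g u₀)) gu₄ (invariant g∈ r₀₄))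
                  (λ gu₀≡u₀ → u₀≢u₃ (injective (trans gu₀≡u₀ (sym gu₃))))

    gu₂ : g u₂ ≡ u₁
    gu₂ = out-of-u₀ (subst (flip R (g u₂)) gu₃ (invariant g∈ r₃₂))
                    (λ gu₂≡u₄ → u₂≢u₄ (injective (trans gu₂≡u₄ (sym gu₄))))

    gu₁ : g u₁ ≡ u₂
    gu₁ = out-of-u₃ (subst (flip R (g u₁)) gu₀ (invariant g∈ r₀₁))
                    (λ gu₁≡u₄ → u₁≢u₄ (injective (trans gu₁≡u₄ (sym gu₄))))

  forwardPath₂⇒dirPath₃ : (C : Cycle Γ 4) → let c = Cycle.vtx C in
                          ∀ i → (∀ k → k < 2 → R (c (step i k)) (c (step i (ℕ.suc k)))) → HasDirPath R c 3
  forwardPath₂⇒dirPath₃ C i p =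
    extend (total (Cycle.edges C (step i 2))) (total edge₄₀) (total (Cycle.edges C (step i 3)))
    where
    c = Cycle.vtx C
    inj = Cycle.inj C
    u : ℕ → V Γ
    u k = c (step i k)

    r₀₁ : R (u 0) (u 1)
    r₀₁ = p 0 ℕ.z<s

    r₁₂ : R (u 1) (u 2)
    r₁₂ = p 1 (ℕ.s<s ℕ.z<s)

    around : (P : Fin 5 → Set) → P i → P (step i 5)
    around P = subst P (sym (step-5 i))

    edge₄₀ : E Γ (u 4) (c i)
    edge₄₀ = subst (E Γ (u 4) ∘ c) (step-5 i) (Cycle.edges C (step i 4))

    extend : R (u 2) (u 3) ⊎ R (u 3) (u 2) → R (u 4) (u 0) ⊎ R (u 0) (u 4) →
             R (u 3) (u 4) ⊎ R (u 4) (u 3) → HasDirPath R c 3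
    extend (inj₁ r₂₃) _ _ = forward-path₃ R c i r₀₁ r₁₂ r₂₃
    extend (inj₂ _) (inj₁ r₄₀) _ =
      forward-path₃ R c (step i 4) (around (λ j → R (u 4) (c j)) r₄₀)
        (around (λ j → R (c j) (c (next j))) r₀₁)
        (around (λ j → R (c (next j)) (c (next (next j)))) r₁₂)
    extend (inj₂ r₃₂) (inj₂ r₀₄) (inj₁ r₃₄) =
      ⊥-elim (¬type2-pentagon r₀₁ r₁₂ r₃₂ r₃₄ r₀₄
               (≢-step-3 (step i 1) ∘ inj) (≢-step-2 (step i 2) ∘ inj)
               (≢-step-2 (step i 1) ∘ inj) (≢-step-3 i ∘ inj))
    extend (inj₂ r₃₂) (inj₂ r₀₄) (inj₂ r₄₃) =
      backward-path₃ R c (step i 2) r₃₂ r₄₃ (around (λ j → R (c j) (u 4)) r₀₄)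

dirPath₂⇒dirPath₃ : ∀ {Γ} → Tetravalent Γ → ∀ {G : AutGroup Γ} → VertexTransitive G →
                    ∀ {R} → IsArcOrbitOrientation G R → (C : Cycle Γ 4) →
                    HasDirPath R (Cycle.vtx C) 2 → HasDirPath R (Cycle.vtx C) 3
dirPath₂⇒dirPath₃ tet vt O C (i , inj₁ forward) = Type2.forwardPath₂⇒dirPath₃ tet vt O C i forward
dirPath₂⇒dirPath₃ tet {G} vt {R} O C (i , inj₂ backward) =
  HasDirPath-flip R (Cycle.vtx C)
    (Type2.forwardPath₂⇒dirPath₃ tet vt (flip-isArcOrbitOrientation G O) C i backward)

proposition5p1 : (Γ : Graph) → Tetravalent Γ → HasGirth Γ 5 →
    (G : AutGroup Γ) → HalfArcTransitive G →
    ∀ a b → E Γ a b → (C : Cycle Γ 4) →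
    ¬ HasType (InducedOrientation G a b) (Cycle.vtx C) 2
proposition5p1 Γ tet _ G hat a b eab C (inj₁ (() , _))
proposition5p1 Γ tet _ G hat@(vt , _) a b eab C (inj₂ (_ , _ , _ , path₂ , ¬path₃)) =
  ¬path₃ (dirPath₂⇒dirPath₃ tet vt (inducedOrientation-isArcOrbitOrientation G hat eab) C path₂)
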